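{- The sequence $(K_3,K_3,K_3,K_3)$ is nice. In particular, $r^*(K_3,K_3,K_3,K_3)=R(3,3,3)-1=16$.
   Context: $R(3,3,3)$ is the three-colour Ramsey number of the triangle. A colouring $\xi:\binom{[r]}{\le 2}\to[4]$ (on subsets of $[r]$ of size at most 2) is feasible with respect to $(K_3,K_3,K_3,K_3)$ if (P1) there is no triangle in $[r]$ all of whose pairs receive the same colour, and (P2) $\xi(\{x,y\})\ne\xi(\{x\})$ for all distinct $x,y\in[r]$. $r^*(K_3,K_3,K_3,K_3)$ is the largest $r$ admitting a feasible colouring, and the sequence is nice if every feasible colouring of $\binom{[r^*]}{\le 2}$ assigns the same colour to all singletons. -}

module Defs where

open import Data.Nat using (ℕ; _<_)
open import Data.Fin using (Fin)
open import Data.Product using (Σ; ∃; _×_)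
open import Relation.Binary.PropositionalEquality using (_≡_; _≢_)
open import Relation.Nullary using (¬_)

-- A colouring ξ of the subsets of [r] of size at most 2 with colours from [k]:
-- 'vtx x' is ξ({x}); 'edge x y' is ξ({x,y}) for x ≢ y.  Since pairs are
-- unordered, 'edge' is required to be symmetric; its values on the diagonal
-- (x = y) are irrelevant and never used.
record Colouring (r k : ℕ) : Set where
  field
    vtx  : Fin r → Fin k
    edge : Fin r → Fin r → Fin k
    sym  : ∀ x y → edge x y ≡ edge y x
open Colouring public

MonoTriangle : ∀ {r k} → (Fin r → Fin r → Fin k) → Set
MonoTriangle {r} e =
  Σ (Fin r) λ x → Σ (Fin r) λ y → Σ (Fin r) λ z →
    x ≢ y × y ≢ z × x ≢ z × e x y ≡ e y z × e x y ≡ e x z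

-- Feasibility with respect to (K3,K3,K3,K3): colours are Fin 4.
-- (P1) no monochromatic triangle; (P2) ξ({x,y}) ≠ ξ({x}) for distinct x,y.
Feasible : ∀ {r} → Colouring r 4 → Set
Feasible {r} ξ =
  ¬ MonoTriangle (edge ξ)
  × (∀ (x y : Fin r) → x ≢ y → edge ξ x y ≢ vtx ξ x)

HasFeasible : ℕ → Set
HasFeasible r = Σ (Colouring r 4) Feasible

IsRStar : ℕ → Set
IsRStar n = HasFeasible n × (∀ r → n < r → ¬ HasFeasible r)

AllSingletonsSameColour : ∀ {r} → Colouring r 4 → Set
AllSingletonsSameColour {r} ξ = ∀ (x y : Fin r) → vtx ξ x ≡ vtx ξ y

NiceAt : ℕ → Set
NiceAt n = ∀ (ξ : Colouring n 4) → Feasible ξ → AllSingletonsSameColour ξ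

record EdgeColouring (r k : ℕ) : Set where
  field
    col    : Fin r → Fin r → Fin k
    colSym : ∀ x y → col x y ≡ col y x
open EdgeColouring public

Arrows333 : ℕ → Set
Arrows333 r = ∀ (c : EdgeColouring r 3) → MonoTriangle (col c)

IsR333 : ℕ → Set
IsR333 n = Arrows333 n × (∀ m → m < n → ¬ Arrows333 m)

-- Let A be a set of j colours and S a set of vertices whose vertex and edge
-- colours all lie in A.  Pick u ∈ S: the other vertices split according to the
-- colour d of their edge to u.  Here d ≠ ξ(u) by (P2), and the class of d uses
-- only the colours A ∖ {d}: its vertices avoid d by (P2) and its edges avoid d
-- since there is no monochromatic triangle at u.  Hence |S| ≤ maxSize j, where
-- maxSize 0 = 0 and maxSize (j + 1) = 1 + j · maxSize j, so maxSize 4 = 16.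
--
-- If |S| = maxSize j with j ≥ 3, every class is tight and, inductively, has all its
-- vertices of one colour (for j = 2 this holds for any S, as an edge colour
-- differs from the colours of both its ends).  Counting the vertices of colour
-- c in S through the classes at u then shows that this number is congruent to
-- [ξ(u) = c] modulo maxSize (j - 1) ≥ 2, so ξ is constant on S.
--
-- A 3-edge-colouring without monochromatic triangles becomes feasible by giving
-- every vertex the fourth colour, so R(3,3,3) ≤ 17; the Greenwood–Gleason
-- colouring of K₁₆ shows R(3,3,3) > 16.
module Submission where

open import Data.Bool using (Bool; true; false; T; _∧_; not)
open import Data.Bool.Properties using (T-∧; ∧-assoc; ∧-comm)
open import Data.Empty using (⊥-elim)
open import Data.Fin using (Fin; zero; suc; inject₁; fromℕ; inject≤)
open import Data.Fin.Properties
  using (_≟_; any?; all?; inject₁-injective; fromℕ≢inject₁; inject≤-injective)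
open import Data.Nat using (ℕ; zero; suc; _+_; _*_; _≤_; _<_; z≤n; s≤s)
open import Data.Nat.Divisibility using (_∣_; _∣0; ∣m∣n⇒∣m+n; ∣m+n∣m⇒∣n; ∣1⇒≡1; n∣m*n)
open import Data.Nat.Properties
  using (+-*-semiring; +-mono-≤; +-cancelʳ-≤; +-cancelˡ-≡; +-comm; +-identityʳ; *-identityʳ;
         *-identityˡ; *-zeroʳ; ≤-antisym; ≤-refl; ≤-reflexive; ≤-trans; <⇒≱; 1+n≰n; 0≢1+n;
         suc-injective; module ≤-Reasoning)
open import Algebra.Properties.Semiring.Sum +-*-semiring
  using (sum-syntax; sum-cong-≗; sum-replicate-zero; ∑-distrib-+; ∑-comm; *-distribʳ-sum)
open import Data.Product using (_×_; _,_; proj₁; proj₂; map)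
open import Data.Vec using (Vec; []; _∷_; lookup)
open import Function using (_∘_; Equivalence)
open import Function.Definitions using (Injective)
open import Relation.Binary.PropositionalEquality
  using (_≡_; _≢_; _≗_; refl; sym; ≢-sym; trans; cong; cong₂; subst; module ≡-Reasoning)
open import Relation.Nullary using (¬_; Dec; yes; no; ¬?)
open import Relation.Nullary.Decidable
  using (⌊_⌋; ⌊⌋-map′; map′; T?; toWitness; fromWitness; toWitnessFalse; fromWitnessFalse;
         from-yes; from-no; _×-dec_; decidable-stable)
open import Defs hiding (sym)

open Equivalence using (to; from)

χ : Bool → ℕ
χ true  = 1
χ false = 0

χ-T : ∀ {b} → T b → χ b ≡ 1
χ-T {true} _ = refl

χ-¬T : ∀ {b} → ¬ T b → χ b ≡ 0
χ-¬T {true}  ¬b = ⊥-elim (¬b _)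
χ-¬T {false} _  = refl

χ-T-* : ∀ {b} m → T b → χ b * m ≡ m
χ-T-* m b = trans (cong (_* m) (χ-T b)) (*-identityˡ m)

χ-∧ : ∀ a b → χ (a ∧ b) ≡ χ b * χ a
χ-∧ true  b = sym (*-identityʳ (χ b))
χ-∧ false b = sym (*-zeroʳ (χ b))

χ-∧-T : ∀ {a} {b} → T a → χ (a ∧ b) ≡ χ b
χ-∧-T {true} _ = refl

χ-split : ∀ a b → χ a ≡ χ (a ∧ b) + χ (a ∧ not b)
χ-split false _     = refl
χ-split true  true  = refl
χ-split true  false = refl

T⇒-∧≡ˡ : ∀ a b → (T a → T b) → a ∧ b ≡ a
T⇒-∧≡ˡ true  true  _   = refl
T⇒-∧≡ˡ true  false a⇒b = ⊥-elim (a⇒b _)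
T⇒-∧≡ˡ false _     _   = refl

+-mono-≤-tight : ∀ {a b c d} → a ≤ c → b ≤ d → a + b ≡ c + d → a ≡ c × b ≡ d
+-mono-≤-tight {a} {b} {c} {d} a≤c b≤d eq =
  a≡c , +-cancelˡ-≡ a b d (trans eq (cong (_+ d) (sym a≡c)))
  where
  open ≤-Reasoning
  a≡c : a ≡ c
  a≡c = ≤-antisym a≤c (+-cancelʳ-≤ d c a (begin
    c + d ≡⟨ sym eq ⟩
    a + b ≤⟨ +-mono-≤ (≤-refl {a}) b≤d ⟩
    a + d ∎))

∑-mono-≤ : ∀ {n} {f g : Fin n → ℕ} → (∀ i → f i ≤ g i) → ∑[ i < n ] f i ≤ ∑[ i < n ] g i
∑-mono-≤ {zero}  _   = z≤n
∑-mono-≤ {suc n} f≤g = +-mono-≤ (f≤g zero) (∑-mono-≤ (f≤g ∘ suc))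

∑-mono-≤-tight : ∀ {n} {f g : Fin n → ℕ} → (∀ i → f i ≤ g i) →
                 ∑[ i < n ] f i ≡ ∑[ i < n ] g i → ∀ i → f i ≡ g i
∑-mono-≤-tight {suc n} f≤g eq i with +-mono-≤-tight (f≤g zero) (∑-mono-≤ (f≤g ∘ suc)) eq
∑-mono-≤-tight {suc n} f≤g eq zero    | f₀≡g₀ , _ = f₀≡g₀
∑-mono-≤-tight {suc n} f≤g eq (suc i) | _ , eq′  = ∑-mono-≤-tight (f≤g ∘ suc) eq′ i

∑-∣ : ∀ {n m} {f : Fin n → ℕ} → (∀ i → m ∣ f i) → m ∣ ∑[ i < n ] f i
∑-∣ {zero}  {m} _   = m ∣0
∑-∣ {suc n}     m∣f = ∣m∣n⇒∣m+n (m∣f zero) (∑-∣ (m∣f ∘ suc))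

∑-sift : ∀ {n} (u : Fin n) (f : Fin n → ℕ) → ∑[ x < n ] (χ ⌊ u ≟ x ⌋ * f x) ≡ f u
∑-sift {suc n} zero    f = trans (cong₂ _+_ (+-identityʳ (f zero)) (sum-replicate-zero n))
                                 (+-identityʳ (f zero))
∑-sift {suc n} (suc u) f =
  trans (sum-cong-≗ λ x → cong (λ b → χ b * f (suc x)) (⌊⌋-map′ _ _ (u ≟ x))) (∑-sift u (f ∘ suc))

-- Subsets as characteristic functions rather than the vectors of Data.Fin.Subset,
-- so that cardinality is a finite sum.

Subset : ℕ → Set
Subset n = Fin n → Bool

module _ {n : ℕ} where

  infix  4 _∈_ _∉_ _∈?_
  infixl 6 _-_
  infixl 7 _∩_

  -- A record rather than T (S x), so that S can be inferred from a membership proof.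
  record _∈_ (x : Fin n) (S : Subset n) : Set where
    constructor member
    field holds : T (S x)
  open _∈_ public

  _∉_ : Fin n → Subset n → Set
  x ∉ S = ¬ x ∈ S

  ⊤ : Subset n
  ⊤ _ = true

  _∩_ : Subset n → Subset n → Subset n
  (S ∩ S′) x = S x ∧ S′ x

  _-_ : Subset n → Fin n → Subset n
  (S - u) x = S x ∧ not ⌊ u ≟ x ⌋

  ∣_∣ : Subset n → ℕ
  ∣ S ∣ = ∑[ x < n ] χ (S x)

  ∈-∩⁻ : ∀ {S S′ x} → x ∈ S ∩ S′ → x ∈ S × x ∈ S′
  ∈-∩⁻ (member x∈) = map member member (to T-∧ x∈)

  ∈-∩⁺ : ∀ {S S′ x} → x ∈ S → x ∈ S′ → x ∈ S ∩ S′
  ∈-∩⁺ (member x∈S) (member x∈S′) = member (from T-∧ (x∈S , x∈S′))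

  ∈-remove⁻ : ∀ {S u x} → x ∈ S - u → x ∈ S × u ≢ x
  ∈-remove⁻ x∈ with ∈-∩⁻ x∈
  ... | x∈S , member u≢x = x∈S , toWitnessFalse u≢x

  ∈-remove⁺ : ∀ {S u x} → x ∈ S → u ≢ x → x ∈ S - u
  ∈-remove⁺ x∈S u≢x = ∈-∩⁺ x∈S (member (fromWitnessFalse u≢x))

  _∈?_ : ∀ x S → Dec (x ∈ S)
  x ∈? S = map′ member holds (T? (S x))

  ∣∣-cong : ∀ {S S′} → S ≗ S′ → ∣ S ∣ ≡ ∣ S′ ∣
  ∣∣-cong S≗S′ = sum-cong-≗ (cong χ ∘ S≗S′)

  ∣∩∣≡∣∣ : ∀ {S S′} → (∀ {x} → x ∈ S → x ∈ S′) → ∣ S ∩ S′ ∣ ≡ ∣ S ∣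
  ∣∩∣≡∣∣ {S} {S′} S⊆S′ = ∣∣-cong λ x → T⇒-∧≡ˡ (S x) (S′ x) (holds ∘ S⊆S′ ∘ member)

  ∣∣≡0 : ∀ {S} → (∀ x → x ∉ S) → ∣ S ∣ ≡ 0
  ∣∣≡0 ∅ = trans (sum-cong-≗ λ x → χ-¬T (∅ x ∘ member)) (sum-replicate-zero n)

  ∣∣-remove : ∀ S u → ∣ S ∣ ≡ χ (S u) + ∣ S - u ∣
  ∣∣-remove S u = begin
    ∑[ x < n ] χ (S x)
      ≡⟨ sum-cong-≗ (λ x → χ-split (S x) ⌊ u ≟ x ⌋) ⟩
    ∑[ x < n ] (χ (S x ∧ ⌊ u ≟ x ⌋) + χ ((S - u) x))
      ≡⟨ ∑-distrib-+ (λ x → χ (S x ∧ ⌊ u ≟ x ⌋)) (χ ∘ (S - u)) ⟩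
    ∑[ x < n ] χ (S x ∧ ⌊ u ≟ x ⌋) + ∣ S - u ∣
      ≡⟨ cong (_+ ∣ S - u ∣) (sum-cong-≗ λ x → χ-∧ (S x) _) ⟩
    ∑[ x < n ] (χ ⌊ u ≟ x ⌋ * χ (S x)) + ∣ S - u ∣
      ≡⟨ cong (_+ ∣ S - u ∣) (∑-sift u (χ ∘ S)) ⟩
    χ (S u) + ∣ S - u ∣ ∎
    where open ≡-Reasoning

  ∈⇒∣∣≡suc : ∀ {S u} → u ∈ S → ∣ S ∣ ≡ suc ∣ S - u ∣
  ∈⇒∣∣≡suc {S} {u} u∈S = trans (∣∣-remove S u) (cong (_+ ∣ S - u ∣) (χ-T (holds u∈S)))

  ∣S-x∣≡ : ∀ {S x m} → ∣ S ∣ ≡ suc m → x ∈ S → ∣ S - x ∣ ≡ m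
  ∣S-x∣≡ ∣S∣ x∈S = suc-injective (trans (sym (∈⇒∣∣≡suc x∈S)) ∣S∣)

  3≤∣∣ : ∀ {S a b c} → a ∈ S → b ∈ S → c ∈ S → a ≢ b → a ≢ c → b ≢ c → 3 ≤ ∣ S ∣
  3≤∣∣ {S} {a} {b} {c} a∈ b∈ c∈ a≢b a≢c b≢c = subst (3 ≤_) (sym ∣S∣≡) (s≤s (s≤s (s≤s z≤n)))
    where
    ∣S∣≡ : ∣ S ∣ ≡ 3 + ∣ S - a - b - c ∣
    ∣S∣≡ = trans (∈⇒∣∣≡suc a∈) (cong suc (trans (∈⇒∣∣≡suc (∈-remove⁺ b∈ a≢b))
             (cong suc (∈⇒∣∣≡suc (∈-remove⁺ (∈-remove⁺ c∈ a≢c) b≢c)))))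

  ∣⊤∣≡n : ∣ ⊤ ∣ ≡ n
  ∣⊤∣≡n = ∣⊤∣ {n}
    where
    ∣⊤∣ : ∀ {m} → ∑[ x < m ] χ true ≡ m
    ∣⊤∣ {zero}  = refl
    ∣⊤∣ {suc m} = cong suc (∣⊤∣ {m})

fibre : ∀ {n k} → (Fin n → Fin k) → Fin k → Subset n
fibre g d x = ⌊ g x ≟ d ⌋

∈-fibre⁻ : ∀ {n k} {g : Fin n → Fin k} {d x} → x ∈ fibre g d → g x ≡ d
∈-fibre⁻ = toWitness ∘ holds

∈-fibre⁺ : ∀ {n k} {g : Fin n → Fin k} {d x} → g x ≡ d → x ∈ fibre g d
∈-fibre⁺ = member ∘ fromWitness

∣∣-fibres : ∀ {n k} (g : Fin n → Fin k) S → ∣ S ∣ ≡ ∑[ d < k ] ∣ S ∩ fibre g d ∣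
∣∣-fibres {n} {k} g S = begin
  ∑[ x < n ] χ (S x)
    ≡⟨ sum-cong-≗ (λ x → sym (∑-sift (g x) (λ _ → χ (S x)))) ⟩
  ∑[ x < n ] ∑[ d < k ] (χ ⌊ g x ≟ d ⌋ * χ (S x))
    ≡⟨ sum-cong-≗ (λ x → sum-cong-≗ λ d → sym (χ-∧ (S x) ⌊ g x ≟ d ⌋)) ⟩
  ∑[ x < n ] ∑[ d < k ] χ ((S ∩ fibre g d) x)
    ≡⟨ ∑-comm (λ x d → χ ((S ∩ fibre g d) x)) ⟩
  ∑[ d < k ] ∣ S ∩ fibre g d ∣ ∎
  where open ≡-Reasoning

nbhd : ∀ {r k} → (Fin r → Fin r → Fin k) → Subset r → Fin r → Fin k → Subset r
nbhd e S u d = (S - u) ∩ fibre (e u) d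

module _ {r k : ℕ} (e : Fin r → Fin r → Fin k) where

  ∈-nbhd⁻ : ∀ {S u d y} → y ∈ nbhd e S u d → y ∈ S × u ≢ y × e u y ≡ d
  ∈-nbhd⁻ {S} {u} {d} y∈ with ∈-∩⁻ {S = S - u} {S′ = fibre (e u) d} y∈
  ... | y∈S-u , colour = proj₁ (∈-remove⁻ y∈S-u) , proj₂ (∈-remove⁻ y∈S-u) , ∈-fibre⁻ colour

  ∣∣-split : ∀ S u → ∣ S ∣ ≡ χ (S u) + ∑[ d < k ] ∣ nbhd e S u d ∣
  ∣∣-split S u = trans (∣∣-remove S u) (cong (χ (S u) +_) (∣∣-fibres (e u) (S - u)))

  ∈⇒∣∣≡suc∑nbhd : ∀ {S u} → u ∈ S → ∣ S ∣ ≡ suc (∑[ d < k ] ∣ nbhd e S u d ∣)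
  ∈⇒∣∣≡suc∑nbhd {S} {u} u∈S =
    trans (∣∣-split S u) (cong (_+ ∑[ d < k ] ∣ nbhd e S u d ∣) (χ-T (holds u∈S)))

  nbhd-∩ : ∀ S S′ u d → nbhd e (S ∩ S′) u d ≗ nbhd e S u d ∩ S′
  nbhd-∩ S S′ u d x = ∧-swap (S x) (S′ x) (not ⌊ u ≟ x ⌋) ⌊ e u x ≟ d ⌋
    where
    ∧-swap : ∀ a b c d → ((a ∧ b) ∧ c) ∧ d ≡ ((a ∧ c) ∧ d) ∧ b
    ∧-swap false _ _ _ = refl
    ∧-swap true  b c d = trans (∧-assoc b c d) (∧-comm b (c ∧ d))

maxSize : ℕ → ℕ
maxSize zero    = 0
maxSize (suc j) = suc (j * maxSize j)

module FeasibleColouring {r k : ℕ} (ξ : Colouring r k)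
  (noMono : ¬ MonoTriangle (edge ξ))
  (proper : ∀ x y → x ≢ y → edge ξ x y ≢ vtx ξ x) where

  record UsesOnly (A : Subset k) (S : Subset r) : Set where
    field
      vtx∈  : ∀ {x} → x ∈ S → vtx ξ x ∈ A
      edge∈ : ∀ {x y} → x ∈ S → y ∈ S → x ≢ y → edge ξ x y ∈ A
  open UsesOnly

  usesOnly-⊤ : UsesOnly ⊤ ⊤
  usesOnly-⊤ = record { vtx∈ = λ _ → member _ ; edge∈ = λ _ _ _ → member _ }

  N : Subset r → Fin r → Fin k → Subset r
  N = nbhd (edge ξ)

  module _ {A S u} (use : UsesOnly A S) (u∈S : u ∈ S) where

    nbhd-colour∈ : ∀ {d y} → y ∈ N S u d → d ∈ A - vtx ξ u
    nbhd-colour∈ y∈ with ∈-nbhd⁻ (edge ξ) y∈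
    ... | y∈S , u≢y , refl = ∈-remove⁺ (edge∈ use u∈S y∈S u≢y) (≢-sym (proper u _ u≢y))

    nbhd-usesOnly : ∀ {d} → UsesOnly (A - d) (N S u d)
    vtx∈ nbhd-usesOnly {y} y∈ with ∈-nbhd⁻ (edge ξ) y∈
    ... | y∈S , u≢y , refl = ∈-remove⁺ (vtx∈ use y∈S) λ d≡vy →
      proper y u (≢-sym u≢y) (trans (Colouring.sym ξ y u) d≡vy)
    edge∈ nbhd-usesOnly {y} {z} y∈ z∈ y≢z with ∈-nbhd⁻ (edge ξ) y∈ | ∈-nbhd⁻ (edge ξ) z∈
    ... | y∈S , u≢y , refl | z∈S , u≢z , uz≡uy = ∈-remove⁺ (edge∈ use y∈S z∈S y≢z) λ uy≡yz →
      noMono (u , y , z , u≢y , y≢z , u≢z , uy≡yz , sym uz≡uy)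

    nbhd-≤ : ∀ {j} → (∀ {A′ S′} → ∣ A′ ∣ ≡ j → UsesOnly A′ S′ → ∣ S′ ∣ ≤ maxSize j) →
             ∣ A ∣ ≡ suc j → ∀ d → ∣ N S u d ∣ ≤ χ ((A - vtx ξ u) d) * maxSize j
    nbhd-≤ {j} bound ∣A∣ d with d ∈? (A - vtx ξ u)
    ... | yes d∈ = ≤-trans (bound (∣S-x∣≡ ∣A∣ (proj₁ (∈-remove⁻ d∈))) nbhd-usesOnly)
                           (≤-reflexive (sym (χ-T-* (maxSize j) (holds d∈))))
    ... | no d∉ = ≤-reflexive (trans (∣∣≡0 λ _ y∈ → d∉ (nbhd-colour∈ y∈))
                                     (cong (_* maxSize j) (sym (χ-¬T (d∉ ∘ member)))))

    ∑-palette : ∀ {j} m → ∣ A ∣ ≡ suc j → ∑[ d < k ] (χ ((A - vtx ξ u) d) * m) ≡ j * m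
    ∑-palette m ∣A∣ = trans (sym (*-distribʳ-sum m (χ ∘ (A - vtx ξ u))))
                            (cong (_* m) (∣S-x∣≡ ∣A∣ (vtx∈ use u∈S)))

  ∣∣≤maxSize : ∀ j {A S} → ∣ A ∣ ≡ j → UsesOnly A S → ∣ S ∣ ≤ maxSize j
  ∣∣≤maxSize zero ∣A∣ use =
    ≤-reflexive (∣∣≡0 λ _ x∈S → 0≢1+n (trans (sym ∣A∣) (∈⇒∣∣≡suc (vtx∈ use x∈S))))
  ∣∣≤maxSize (suc j) {A} {S} ∣A∣ use with any? (_∈? S)
  ... | no ∄u = ≤-trans (≤-reflexive (∣∣≡0 λ u u∈S → ∄u (u , u∈S))) z≤n
  ... | yes (u , u∈S) = begin
    ∣ S ∣
      ≡⟨ ∈⇒∣∣≡suc∑nbhd (edge ξ) u∈S ⟩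
    suc (∑[ d < k ] ∣ N S u d ∣)
      ≤⟨ s≤s (∑-mono-≤ (nbhd-≤ use u∈S (∣∣≤maxSize j) ∣A∣)) ⟩
    suc (∑[ d < k ] (χ ((A - vtx ξ u) d) * maxSize j))
      ≡⟨ cong suc (∑-palette use u∈S (maxSize j) ∣A∣) ⟩
    suc (j * maxSize j) ∎
    where open ≤-Reasoning

  tight-nbhd : ∀ {j A S u} → ∣ A ∣ ≡ suc j → UsesOnly A S → ∣ S ∣ ≡ maxSize (suc j) → u ∈ S →
               ∀ d → ∣ N S u d ∣ ≡ χ ((A - vtx ξ u) d) * maxSize j
  tight-nbhd {j} {A} {S} {u} ∣A∣ use tight u∈S =
    ∑-mono-≤-tight (nbhd-≤ use u∈S (∣∣≤maxSize j) ∣A∣) (suc-injective (begin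
      suc (∑[ d < k ] ∣ N S u d ∣)
        ≡⟨ sym (∈⇒∣∣≡suc∑nbhd (edge ξ) u∈S) ⟩
      ∣ S ∣
        ≡⟨ tight ⟩
      suc (j * maxSize j)
        ≡⟨ cong suc (sym (∑-palette use u∈S (maxSize j) ∣A∣)) ⟩
      suc (∑[ d < k ] (χ ((A - vtx ξ u) d) * maxSize j)) ∎))
    where open ≡-Reasoning

  Monochromatic : Subset r → Set
  Monochromatic S = ∀ {x y} → x ∈ S → y ∈ S → vtx ξ x ≡ vtx ξ y

  colourClass : Fin k → Subset r
  colourClass = fibre (vtx ξ)

  monochromatic-∣∩colourClass∣ : ∀ {S m} c → Monochromatic S → m ∣ ∣ S ∣ → m ∣ ∣ S ∩ colourClass c ∣
  monochromatic-∣∩colourClass∣ {S} c mono m∣S with any? (_∈? (S ∩ colourClass c))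
  ... | yes (w , w∈) = subst (_ ∣_) (sym (∣∩∣≡∣∣ S⊆)) m∣S
    where
    S⊆ : ∀ {x} → x ∈ S → x ∈ colourClass c
    S⊆ x∈S with ∈-∩⁻ w∈
    ... | w∈S , w∈c = ∈-fibre⁺ (trans (mono x∈S w∈S) (∈-fibre⁻ w∈c))
  ... | no ∄x = subst (_ ∣_) (sym (∣∣≡0 λ x x∈ → ∄x (x , x∈))) (_ ∣0)

  usesOnly-2⇒monochromatic : ∀ {A S} → ∣ A ∣ ≡ 2 → UsesOnly A S → Monochromatic S
  usesOnly-2⇒monochromatic ∣A∣ use {x} {y} x∈ y∈ with vtx ξ x ≟ vtx ξ y
  ... | yes same = same
  ... | no differ = ⊥-elim (1+n≰n (≤-trans (3≤∣∣ (edge∈ use x∈ y∈ x≢y) (vtx∈ use x∈) (vtx∈ use y∈)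
                                                  (proper x y x≢y) xy≢vy differ)
                                             (≤-reflexive ∣A∣)))
    where
    x≢y : x ≢ y
    x≢y = differ ∘ cong (vtx ξ)
    xy≢vy : edge ξ x y ≢ vtx ξ y
    xy≢vy = proper y x (≢-sym x≢y) ∘ trans (Colouring.sym ξ y x)

  module _ {j A S} (IH : ∀ {A′ S′} → ∣ A′ ∣ ≡ 2 + j → UsesOnly A′ S′ → ∣ S′ ∣ ≡ maxSize (2 + j) →
                         Monochromatic S′)
           (∣A∣ : ∣ A ∣ ≡ 3 + j) (use : UsesOnly A S) (tight : ∣ S ∣ ≡ maxSize (3 + j)) where

    nbhd-monochromatic : ∀ {u} → u ∈ S → ∀ d → Monochromatic (N S u d)
    nbhd-monochromatic {u} u∈S d with d ∈? (A - vtx ξ u)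
    ... | yes d∈ = IH (∣S-x∣≡ ∣A∣ (proj₁ (∈-remove⁻ d∈))) (nbhd-usesOnly use u∈S)
                      (trans (tight-nbhd ∣A∣ use tight u∈S d) (χ-T-* (maxSize (2 + j)) (holds d∈)))
    ... | no d∉ = λ y∈ _ → ⊥-elim (d∉ (nbhd-colour∈ use u∈S y∈))

    maxSize∣∑nbhd∩colourClass : ∀ {u} → u ∈ S → ∀ c →
      maxSize (2 + j) ∣ ∑[ d < k ] ∣ N (S ∩ colourClass c) u d ∣
    maxSize∣∑nbhd∩colourClass {u} u∈S c = ∑-∣ λ d →
      subst (_ ∣_) (sym (∣∣-cong (nbhd-∩ (edge ξ) S (colourClass c) _ d)))
        (monochromatic-∣∩colourClass∣ c (nbhd-monochromatic u∈S d)
          (subst (_ ∣_) (sym (tight-nbhd ∣A∣ use tight u∈S d)) (n∣m*n (χ ((A - vtx ξ u) d)))))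

  ∣∩colourClass∣-split : ∀ {S u} c → u ∈ S →
    ∣ S ∩ colourClass c ∣ ≡ χ ⌊ vtx ξ u ≟ c ⌋ + ∑[ d < k ] ∣ N (S ∩ colourClass c) u d ∣
  ∣∩colourClass∣-split {S} {u} c u∈S =
    trans (∣∣-split (edge ξ) (S ∩ colourClass c) u)
          (cong (_+ ∑[ d < k ] ∣ N (S ∩ colourClass c) u d ∣) (χ-∧-T (holds u∈S)))

  tight⇒monochromatic : ∀ j {A S} → ∣ A ∣ ≡ 2 + j → UsesOnly A S → ∣ S ∣ ≡ maxSize (2 + j) →
                        Monochromatic S
  tight⇒monochromatic zero    ∣A∣ use _ = usesOnly-2⇒monochromatic ∣A∣ use
  tight⇒monochromatic (suc j) {A} {S} ∣A∣ use tight {y} {z} y∈ z∈ with vtx ξ y ≟ vtx ξ z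
  ... | yes same = same
  ... | no differ = ⊥-elim (maxSize≢1 (∣1⇒≡1 (∣m+n∣m⇒∣n (subst (_ ∣_) count-via-z (maxSize∣X z∈))
                                                        (maxSize∣X y∈))))
    where
    c = vtx ξ y
    X : Fin r → ℕ
    X u = ∑[ d < k ] ∣ N (S ∩ colourClass c) u d ∣
    maxSize∣X : ∀ {u} → u ∈ S → maxSize (2 + j) ∣ X u
    maxSize∣X u∈S = maxSize∣∑nbhd∩colourClass (tight⇒monochromatic j) ∣A∣ use tight u∈S c
    maxSize≢1 : maxSize (2 + j) ≢ 1
    maxSize≢1 ()
    count-via-z : X z ≡ X y + 1
    count-via-z = begin
      X z                      ≡⟨ cong (_+ X z) (χ-¬T {⌊ vtx ξ z ≟ c ⌋} (differ ∘ sym ∘ toWitness)) ⟨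
      χ ⌊ vtx ξ z ≟ c ⌋ + X z  ≡⟨ ∣∩colourClass∣-split c z∈ ⟨
      ∣ S ∩ colourClass c ∣    ≡⟨ ∣∩colourClass∣-split c y∈ ⟩
      χ ⌊ c ≟ c ⌋ + X y        ≡⟨ cong (_+ X y) (χ-T {⌊ c ≟ c ⌋} (fromWitness refl)) ⟩
      1 + X y                  ≡⟨ +-comm 1 (X y) ⟩
      X y + 1 ∎
      where open ≡-Reasoning

monoTriangle? : ∀ {r k} (e : Fin r → Fin r → Fin k) → Dec (MonoTriangle e)
monoTriangle? e = any? λ x → any? λ y → any? λ z →
  ¬? (x ≟ y) ×-dec ¬? (y ≟ z) ×-dec ¬? (x ≟ z) ×-dec e x y ≟ e y z ×-dec e x y ≟ e x z

MonoTriangle-recolour⁻ : ∀ {r k k′} {h : Fin k → Fin k′} → Injective _≡_ _≡_ h →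
  (e : Fin r → Fin r → Fin k) → MonoTriangle (λ x y → h (e x y)) → MonoTriangle e
MonoTriangle-recolour⁻ h-inj e (x , y , z , x≢y , y≢z , x≢z , xy≡yz , xy≡xz) =
  x , y , z , x≢y , y≢z , x≢z , h-inj xy≡yz , h-inj xy≡xz

MonoTriangle-restrict⁻ : ∀ {r s k} {g : Fin r → Fin s} → Injective _≡_ _≡_ g →
  (e : Fin s → Fin s → Fin k) → MonoTriangle (λ x y → e (g x) (g y)) → MonoTriangle e
MonoTriangle-restrict⁻ {g = g} g-inj e (x , y , z , x≢y , y≢z , x≢z , xy≡yz , xy≡xz) =
  g x , g y , g z , x≢y ∘ g-inj , y≢z ∘ g-inj , x≢z ∘ g-inj , xy≡yz , xy≡xz

feasible-extension : ∀ {r} (c : EdgeColouring r 3) → ¬ MonoTriangle (col c) → HasFeasible r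
feasible-extension c noMono =
  record { vtx  = λ _ → fromℕ 3
         ; edge = λ x y → inject₁ (col c x y)
         ; sym  = λ x y → cong inject₁ (colSym c x y) } ,
  noMono ∘ MonoTriangle-recolour⁻ inject₁-injective (col c) ,
  λ _ _ _ e → fromℕ≢inject₁ (sym e)

noFeasible>16 : ∀ r → 16 < r → ¬ HasFeasible r
noFeasible>16 r 16<r (ξ , noMono , proper) =
  <⇒≱ 16<r (subst (_≤ 16) ∣⊤∣≡n (∣∣≤maxSize 4 refl usesOnly-⊤))
  where open FeasibleColouring ξ noMono proper

niceAt16 : NiceAt 16
niceAt16 ξ (noMono , proper) x y = tight⇒monochromatic 2 refl usesOnly-⊤ ∣⊤∣≡n (member _) (member _)
  where open FeasibleColouring ξ noMono proper

arrows17 : Arrows333 17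
arrows17 c = decidable-stable (monoTriangle? (col c)) λ noMono →
  noFeasible>16 17 ≤-refl (feasible-extension c noMono)

greenwoodGleason : EdgeColouring 16 3
greenwoodGleason = record
  { col    = colour
  ; colSym = from-yes (all? λ x → all? λ y → colour x y ≟ colour y x) }
  where
  c0 c1 c2 : Fin 3
  c0 = zero
  c1 = suc zero
  c2 = suc (suc zero)
  table : Vec (Vec (Fin 3) 16) 16
  table =
    (c0 ∷ c0 ∷ c0 ∷ c1 ∷ c0 ∷ c1 ∷ c2 ∷ c1 ∷ c0 ∷ c2 ∷ c1 ∷ c1 ∷ c2 ∷ c2 ∷ c2 ∷ c0 ∷ []) ∷
    (c0 ∷ c0 ∷ c1 ∷ c0 ∷ c1 ∷ c0 ∷ c1 ∷ c2 ∷ c2 ∷ c0 ∷ c1 ∷ c1 ∷ c2 ∷ c2 ∷ c0 ∷ c2 ∷ []) ∷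
    (c0 ∷ c1 ∷ c0 ∷ c0 ∷ c2 ∷ c1 ∷ c0 ∷ c1 ∷ c1 ∷ c1 ∷ c0 ∷ c2 ∷ c2 ∷ c0 ∷ c2 ∷ c2 ∷ []) ∷
    (c1 ∷ c0 ∷ c0 ∷ c0 ∷ c1 ∷ c2 ∷ c1 ∷ c0 ∷ c1 ∷ c1 ∷ c2 ∷ c0 ∷ c0 ∷ c2 ∷ c2 ∷ c2 ∷ []) ∷
    (c0 ∷ c1 ∷ c2 ∷ c1 ∷ c0 ∷ c0 ∷ c0 ∷ c1 ∷ c2 ∷ c2 ∷ c2 ∷ c0 ∷ c0 ∷ c2 ∷ c1 ∷ c1 ∷ []) ∷
    (c1 ∷ c0 ∷ c1 ∷ c2 ∷ c0 ∷ c0 ∷ c1 ∷ c0 ∷ c2 ∷ c2 ∷ c0 ∷ c2 ∷ c2 ∷ c0 ∷ c1 ∷ c1 ∷ []) ∷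
    (c2 ∷ c1 ∷ c0 ∷ c1 ∷ c0 ∷ c1 ∷ c0 ∷ c0 ∷ c2 ∷ c0 ∷ c2 ∷ c2 ∷ c1 ∷ c1 ∷ c0 ∷ c2 ∷ []) ∷
    (c1 ∷ c2 ∷ c1 ∷ c0 ∷ c1 ∷ c0 ∷ c0 ∷ c0 ∷ c0 ∷ c2 ∷ c2 ∷ c2 ∷ c1 ∷ c1 ∷ c2 ∷ c0 ∷ []) ∷
    (c0 ∷ c2 ∷ c1 ∷ c1 ∷ c2 ∷ c2 ∷ c2 ∷ c0 ∷ c0 ∷ c0 ∷ c0 ∷ c1 ∷ c0 ∷ c1 ∷ c2 ∷ c1 ∷ []) ∷
    (c2 ∷ c0 ∷ c1 ∷ c1 ∷ c2 ∷ c2 ∷ c0 ∷ c2 ∷ c0 ∷ c0 ∷ c1 ∷ c0 ∷ c1 ∷ c0 ∷ c1 ∷ c2 ∷ []) ∷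
    (c1 ∷ c1 ∷ c0 ∷ c2 ∷ c2 ∷ c0 ∷ c2 ∷ c2 ∷ c0 ∷ c1 ∷ c0 ∷ c0 ∷ c2 ∷ c1 ∷ c0 ∷ c1 ∷ []) ∷
    (c1 ∷ c1 ∷ c2 ∷ c0 ∷ c0 ∷ c2 ∷ c2 ∷ c2 ∷ c1 ∷ c0 ∷ c0 ∷ c0 ∷ c1 ∷ c2 ∷ c1 ∷ c0 ∷ []) ∷
    (c2 ∷ c2 ∷ c2 ∷ c0 ∷ c0 ∷ c2 ∷ c1 ∷ c1 ∷ c0 ∷ c1 ∷ c2 ∷ c1 ∷ c0 ∷ c0 ∷ c0 ∷ c1 ∷ []) ∷
    (c2 ∷ c2 ∷ c0 ∷ c2 ∷ c2 ∷ c0 ∷ c1 ∷ c1 ∷ c1 ∷ c0 ∷ c1 ∷ c2 ∷ c0 ∷ c0 ∷ c1 ∷ c0 ∷ []) ∷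
    (c2 ∷ c0 ∷ c2 ∷ c2 ∷ c1 ∷ c1 ∷ c0 ∷ c2 ∷ c2 ∷ c1 ∷ c0 ∷ c1 ∷ c0 ∷ c1 ∷ c0 ∷ c0 ∷ []) ∷
    (c0 ∷ c2 ∷ c2 ∷ c2 ∷ c1 ∷ c1 ∷ c2 ∷ c0 ∷ c1 ∷ c2 ∷ c1 ∷ c0 ∷ c1 ∷ c0 ∷ c0 ∷ c0 ∷ []) ∷
    []
  colour : Fin 16 → Fin 16 → Fin 3
  colour x y = lookup (lookup table x) y

greenwoodGleason-triangleFree : ¬ MonoTriangle (col greenwoodGleason)
greenwoodGleason-triangleFree = from-no (monoTriangle? (col greenwoodGleason))

¬arrows<17 : ∀ m → m < 17 → ¬ Arrows333 m
¬arrows<17 m (s≤s m≤16) arrows = greenwoodGleason-triangleFree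
  (MonoTriangle-restrict⁻ (inject≤-injective m≤16 m≤16 _ _) (col greenwoodGleason)
    (arrows record { col = λ x y → col greenwoodGleason (inject≤ x m≤16) (inject≤ y m≤16)
                   ; colSym = λ x y → colSym greenwoodGleason (inject≤ x m≤16) (inject≤ y m≤16) }))

theorem1p9 : IsRStar 16 × NiceAt 16 × IsR333 17
theorem1p9 =
  (feasible-extension greenwoodGleason greenwoodGleason-triangleFree , noFeasible>16) ,
  niceAt16 ,
  arrows17 , ¬arrows<17
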